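{- Let $T$ be a tree with at least two regular cores, and let $L\subseteq V$. If for every regular core $v$ of $T$ the set of vertices of $L$ lying on the g-legs of $v$ is a local set of $v$, then $L$ is a landmark set of $T$.
   Context: Let $T=(V,E)$ be a finite tree and $d(x,y)$ the number of edges on the path between $x$ and $y$. A vertex $\tau$ separates $u$ and $w$ if $d(u,\tau)\neq d(w,\tau)$. A set $L\subseteq V$ is a landmark set if every pair of distinct vertices $u,w\in V\setminus L$ is separated by at least two vertices of $L$. A core is a vertex of degree at least $3$. For a vertex $v$, the subtrees of the neighbors of $v$ are the connected components of $T-v$. A (standard) leg of a core $v$ is a subtree of a neighbor of $v$ containing no core (a path attached to $v$); it is short if it has one vertex and long otherwise. For a leg $\ell$ of $v$, $\ell^i$ denotes the vertex of $\ell$ at distance $i$ from $v$ (its position is $i$). A small core is a core of degree exactly $3$ with at least two legs, at least one of which is short; other cores are regular. A modified leg of a core $v$ is a subtree of a neighbor of $v$ containing exactly one core, which is a small core $w$; the position of a vertex on it is its distance from $v$; if $w$ has position $i$, the two vertices of position $i+1$ are $\ell^a,\ell^b$, where $\ell^b$ is the vertex of a short leg of $w$ (chosen arbitrarily if both legs of $w$ inside $\ell$ are short). A g-leg of $v$ is a standard leg or a modified leg of $v$. Solution types. For a set $S$ and a standard leg $\ell$, $S\cap\ell$ is of type $(s,0)$ if empty; $(s,1)$ if it is a single vertex of position at least $2$; $(s,2)$ if it has at least two vertices; $(s,3)$ if it equals $\{\ell^1\}$. For a modified leg $\ell$ whose small core has position $i$: type $(m,1)$ if $S\cap\ell$ equals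 $\{\ell^a\}$ or $\{\ell^b\}$; type $(m,2)$ if it contains neither $\ell^a$ nor $\ell^b$ and contains at least two vertices of position at least $i+2$; type $(m,3)$ if it has at least two vertices, at least one of which is $\ell^a$ or $\ell^b$. A local set of a core $v$ is a set $S$ of vertices of the g-legs of $v$ (so $v\notin S$) such that: (1) at most one standard leg has type $(s,0)$ and all other standard legs have type $(s,1)$, $(s,2)$ or $(s,3)$; (2) every modified leg has type $(m,1)$, $(m,2)$ or $(m,3)$; (3) if some standard leg has type $(s,0)$ then no modified leg has type $(m,1)$; (4) if some long leg $\ell$ has type $(s,0)$ then every long leg other than $\ell$ has type $(s,2)$; (5) if some short leg has type $(s,0)$ then every long leg has type $(s,2)$ or $(s,3)$. -}

module Defs where

open import Data.Nat using (ℕ; zero; suc; _≤_; _+_)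
open import Data.Fin using (Fin)
open import Data.Bool using (Bool; true; false; T)
open import Data.List using (List; []; _∷_; length; filter; allFin)
open import Data.List.Membership.Propositional using () renaming (_∉_ to _∉ᴸ_)
open import Data.List.Relation.Unary.Unique.Propositional using (Unique)
open import Data.Fin.Subset using (Subset; _∈_; _∉_)
open import Data.Product using (Σ; ∃; ∃-syntax; _×_; _,_; proj₁)
open import Data.Sum using (_⊎_)
open import Relation.Nullary using (¬_)
open import Relation.Nullary.Decidable.Core using (T?)
open import Relation.Binary.PropositionalEquality using (_≡_; _≢_)

data Walk {n : ℕ} (adj : Fin n → Fin n → Bool) : Fin n → Fin n → Set where
  here : (x : Fin n) → Walk adj x x
  step : {x y z : Fin n} → T (adj x y) → Walk adj y z → Walk adj x z

vertices : {n : ℕ} {adj : Fin n → Fin n → Bool} {x y : Fin n} →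
           Walk adj x y → List (Fin n)
vertices (here x) = x ∷ []
vertices (step {x = x} _ w) = x ∷ vertices w

len : {n : ℕ} {adj : Fin n → Fin n → Bool} {x y : Fin n} → Walk adj x y → ℕ
len (here x) = 0
len (step _ w) = suc (len w)

IsPath : {n : ℕ} {adj : Fin n → Fin n → Bool} {x y : Fin n} → Walk adj x y → Set
IsPath w = Unique (vertices w)

record Tree : Set where
  field
    n      : ℕ
    adj    : Fin n → Fin n → Bool
    sym    : ∀ x y → adj x y ≡ adj y x
    irrefl : ∀ x → adj x x ≡ false
    conn   : ∀ x y → Σ (Walk adj x y) IsPath
    uniq   : ∀ x y (p q : Walk adj x y) → IsPath p → IsPath q →
             vertices p ≡ vertices q

module _ (G : Tree) where
  open Tree G

  V : Set
  V = Fin n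

  Edge : V → V → Set
  Edge x y = T (adj x y)

  dist : V → V → ℕ
  dist x y = len (proj₁ (conn x y))

  deg : V → ℕ
  deg v = length (filter (λ u → T? (adj v u)) (allFin n))

  Core : V → Set
  Core v = 3 ≤ deg v

  -- x lies in the connected component of T - v containing u
  -- (for u a neighbour of v: "the subtree of the neighbour u of v")
  InComp : V → V → V → Set
  InComp v u x = Σ (Walk adj u x) λ p → v ∉ᴸ vertices p

  IsLeg : V → V → Set
  IsLeg v u = Edge v u × (∀ x → InComp v u x → ¬ Core x)

  ShortLeg : V → V → Set
  ShortLeg v u = IsLeg v u × (∀ x → InComp v u x → x ≡ u)

  LongLeg : V → V → Set
  LongLeg v u = IsLeg v u × ¬ (∀ x → InComp v u x → x ≡ u)

  SmallCore : V → Set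
  SmallCore w = deg w ≡ 3 ×
    (∃[ u₁ ] ∃[ u₂ ] (u₁ ≢ u₂ × IsLeg w u₁ × ShortLeg w u₂))

  RegularCore : V → Set
  RegularCore v = Core v × ¬ SmallCore v

  -- modified leg of v given by the neighbour u, whose unique core is w
  ModLeg : V → V → V → Set
  ModLeg v u w = Edge v u × InComp v u w × SmallCore w ×
    (∀ x → InComp v u x → Core x → x ≡ w)

  GLeg : V → V → Set
  GLeg v u = IsLeg v u ⊎ (∃[ w ] ModLeg v u w)

  OnGLeg : V → V → Set
  OnGLeg v x = ∃[ u ] (GLeg v u × InComp v u x)

  -- Solution types, for a set S (as a predicate) and a g-leg of v given
  -- by the neighbour u; positions are distances from v.

  module _ (S : V → Set) (v u : V) where

    TypeS0 TypeS1 TypeS2 TypeS3 : Set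
    TypeS0 = ∀ x → InComp v u x → ¬ S x
    TypeS1 = ∃[ y ] (InComp v u y × S y × 2 ≤ dist v y ×
                     (∀ x → InComp v u x → S x → x ≡ y))
    TypeS2 = ∃[ x ] ∃[ y ] (x ≢ y × InComp v u x × S x × InComp v u y × S y)
    TypeS3 = S u × (∀ x → InComp v u x → S x → x ≡ u)

    module _ (w : V) where
      -- ℓ^a / ℓ^b : vertices of the modified leg at position (pos w) + 1
      IsAB : V → Set
      IsAB x = InComp v u x × dist v x ≡ suc (dist v w)

      TypeM1 TypeM2 TypeM3 : Set
      TypeM1 = ∃[ y ] (IsAB y × S y × (∀ x → InComp v u x → S x → x ≡ y))
      TypeM2 = (∀ x → IsAB x → ¬ S x) ×
        ∃[ x ] ∃[ y ] (x ≢ y × InComp v u x × S x × suc (suc (dist v w)) ≤ dist v x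
                             × InComp v u y × S y × suc (suc (dist v w)) ≤ dist v y)
      TypeM3 = (∃[ x ] ∃[ y ] (x ≢ y × InComp v u x × S x × InComp v u y × S y))
               × (∃[ z ] (IsAB z × S z))

  record LocalSet (v : V) (S : V → Set) : Set where
    field
      onGLegs : ∀ x → S x → OnGLeg v x
      c1-unique : ∀ u u' → IsLeg v u → IsLeg v u' →
                  TypeS0 S v u → TypeS0 S v u' → u ≡ u'
      c1-types  : ∀ u → IsLeg v u →
                  TypeS0 S v u ⊎ TypeS1 S v u ⊎ TypeS2 S v u ⊎ TypeS3 S v u
      c2 : ∀ u w → ModLeg v u w →
           TypeM1 S v u w ⊎ TypeM2 S v u w ⊎ TypeM3 S v u w
      c3 : (∃[ u ] (IsLeg v u × TypeS0 S v u)) →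
           ∀ u w → ModLeg v u w → ¬ TypeM1 S v u w
      c4 : ∀ u → LongLeg v u → TypeS0 S v u →
           ∀ u' → LongLeg v u' → u' ≢ u → TypeS2 S v u'
      c5 : ∀ u → ShortLeg v u → TypeS0 S v u →
           ∀ u' → LongLeg v u' → TypeS2 S v u' ⊎ TypeS3 S v u'

  Separates : V → V → V → Set
  Separates τ x y = dist x τ ≢ dist y τ

  IsLandmark : Subset n → Set
  IsLandmark L = ∀ x y → x ≢ y → x ∉ L → y ∉ L →
    ∃[ τ₁ ] ∃[ τ₂ ] (τ₁ ≢ τ₂ × τ₁ ∈ L × τ₂ ∈ L ×
                     Separates τ₁ x y × Separates τ₂ x y)

module Submission where

-- Let x ≢ y lie outside L.  If d x y is odd, every vertex separates x and
-- y (trees are bipartite), and two landmarks exist at all, because the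
-- branch at one regular core toward another one contains two.  If d x y
-- is even, x and y lie in the branches of the midpoint m of their path at
-- two distinct neighbours a and b, and every vertex of these branches
-- separates x and y.  Two landmarks are found there: by recursion over
-- nested branches if one of them contains a regular core; from the local
-- set at m if m is regular; and otherwise m is a small core whose legs are
-- the two branches, and the local set at a regular core carrying m on a
-- modified leg places two landmarks beyond m.

open import Defs
open import Data.Fin.Subset using (Subset; _∈_)
open import Data.Product using (∃-syntax; _×_)
open import Relation.Binary.PropositionalEquality using (_≢_)

open import Data.Fin.Subset using (_∉_)
open import Data.Nat using (ℕ; zero; suc; _+_; _≤_; _<_; z≤n; s≤s; _≤?_; _<?_)
open import Data.Nat.Properties
open import Data.Fin using (Fin) renaming (_≟_ to _≟ᶠ_)
import Data.Fin.Properties as Fin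
open import Data.Bool using (T)
open import Data.List using (List; []; _∷_; length; filter; allFin; _++_)
open import Data.List.Relation.Unary.Any using () renaming (here to hd; there to tl)
import Data.List.Relation.Unary.Any as Any
open import Data.List.Relation.Unary.All using (All; []; _∷_)
import Data.List.Relation.Unary.All as All
open import Data.List.Relation.Unary.All.Properties.Core using (¬Any⇒All¬)
open import Data.List.Relation.Unary.AllPairs.Core using ([]; _∷_)
open import Data.List.Membership.Propositional using (find) renaming (_∈_ to _∈ᴸ_; _∉_ to _∉ᴸ_)
open import Data.List.Membership.Propositional.Properties using (∈-filter⁺; ∈-filter⁻; ∈-allFin)
open import Data.List.Relation.Unary.Unique.Propositional using (Unique)
import Data.List.Relation.Unary.Unique.Propositional.Properties as Unique
open import Data.List.Properties using (∷-injectiveˡ; ∷-injectiveʳ)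
open import Data.Product using (Σ; _,_; proj₁; proj₂)
open import Data.Sum using (_⊎_; inj₁; inj₂)
import Data.Sum as Sum
open import Data.Empty using (⊥; ⊥-elim)
open import Data.Unit using (⊤; tt)
open import Relation.Nullary using (¬_; Dec; yes; no)
import Relation.Nullary.Decidable as Dec
open import Relation.Nullary.Decidable.Core using (T?; decidable-stable; ¬?; _×-dec_; _→-dec_)
open import Relation.Binary.PropositionalEquality using (_≡_; ≢-sym; refl; cong; cong₂; subst; trans; sym; module ≡-Reasoning)

-- Geometry of a finite tree G.
module TreeFacts (G : Tree) where
  open Tree G renaming (sym to adj-sym)
  open import Data.List.Membership.DecPropositional (_≟ᶠ_ {n}) using () renaming (_∈?_ to _∈ᴸ?_)

  W : Fin n → Fin n → Set
  W = Walk adj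

  d : Fin n → Fin n → ℕ
  d = dist G

  E : Fin n → Fin n → Set
  E = Edge G

  edge-sym : ∀ {x y} → E x y → E y x
  edge-sym {x} {y} e = subst T (adj-sym x y) e

  edge-irrefl : ∀ {x} → ¬ E x x
  edge-irrefl {x} e = subst T (irrefl x) e

  edge⇒≢ : ∀ {x y} → E x y → x ≢ y
  edge⇒≢ e refl = edge-irrefl e

  _++ʷ_ : ∀ {x y z} → W x y → W y z → W x z
  here _ ++ʷ q = q
  step e p ++ʷ q = step e (p ++ʷ q)

  len-++ : ∀ {x y z} (p : W x y) (q : W y z) → len (p ++ʷ q) ≡ len p + len q
  len-++ (here _) q = refl
  len-++ (step e p) q = cong suc (len-++ p q)

  reverse : ∀ {x y} → W x y → W y x
  reverse (here x) = here x
  reverse (step e p) = reverse p ++ʷ step (edge-sym e) (here _)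

  len-reverse : ∀ {x y} (p : W x y) → len (reverse p) ≡ len p
  len-reverse (here x) = refl
  len-reverse (step e p) = trans (len-++ (reverse p) (step (edge-sym e) (here _)))
                                 (trans (+-comm (len (reverse p)) 1) (cong suc (len-reverse p)))

  start∈ : ∀ {x y} (p : W x y) → x ∈ᴸ vertices p
  start∈ (here x) = hd refl
  start∈ (step e p) = hd refl

  end∈ : ∀ {x y} (p : W x y) → y ∈ᴸ vertices p
  end∈ (here x) = hd refl
  end∈ (step e p) = tl (end∈ p)

  ∈-++ʷ⁻ : ∀ {x y z t} (p : W x y) (q : W y z) → t ∈ᴸ vertices (p ++ʷ q) →
           t ∈ᴸ vertices p ⊎ t ∈ᴸ vertices q
  ∈-++ʷ⁻ (here _) q m = inj₂ m
  ∈-++ʷ⁻ (step e p) q (hd refl) = inj₁ (hd refl)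
  ∈-++ʷ⁻ (step e p) q (tl m) = Sum.map₁ tl (∈-++ʷ⁻ p q m)

  ∈-++ʷ⁺ˡ : ∀ {x y z t} (p : W x y) (q : W y z) → t ∈ᴸ vertices p → t ∈ᴸ vertices (p ++ʷ q)
  ∈-++ʷ⁺ˡ (here _) q (hd refl) = start∈ q
  ∈-++ʷ⁺ˡ (step e p) q (hd refl) = hd refl
  ∈-++ʷ⁺ˡ (step e p) q (tl m) = tl (∈-++ʷ⁺ˡ p q m)

  ∈-++ʷ⁺ʳ : ∀ {x y z t} (p : W x y) (q : W y z) → t ∈ᴸ vertices q → t ∈ᴸ vertices (p ++ʷ q)
  ∈-++ʷ⁺ʳ (here _) q m = m
  ∈-++ʷ⁺ʳ (step e p) q m = tl (∈-++ʷ⁺ʳ p q m)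

  split : ∀ {x y t} (p : W x y) → t ∈ᴸ vertices p →
          Σ (W x t) λ p₁ → Σ (W t y) λ p₂ → p₁ ++ʷ p₂ ≡ p
  split (here x) (hd refl) = here x , here x , refl
  split (step e p) (hd refl) = here _ , step e p , refl
  split (step e p) (tl m) with split p m
  ... | p₁ , p₂ , eq = step e p₁ , p₂ , cong (step e) eq

  splitAt : ∀ {x y} (p : W x y) k → k ≤ len p →
    Σ (Fin n) λ z → Σ (W x z) λ p₁ → Σ (W z y) λ p₂ → (len p₁ ≡ k) × (len p₁ + len p₂ ≡ len p)
  splitAt {x} p zero _ = x , here x , p , refl , refl
  splitAt (step e p) (suc k) (s≤s k≤) with splitAt p k k≤
  ... | z , p₁ , p₂ , a , b = z , step e p₁ , p₂ , cong suc a , cong suc b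

  -- Paths: suffixes of paths are paths, and every path realises the
  -- distance (this is where uniqueness of paths in a tree is used).

  init-vertices : ∀ {x y} → W x y → List (Fin n)
  init-vertices (here _) = []
  init-vertices (step {x = x} _ p) = x ∷ init-vertices p

  vertices-++ : ∀ {x y z} (p : W x y) (q : W y z) →
                vertices (p ++ʷ q) ≡ init-vertices p ++ vertices q
  vertices-++ (here _) q = refl
  vertices-++ (step {x = x} e p) q = cong (x ∷_) (vertices-++ p q)

  unique-suffix : ∀ (xs : List (Fin n)) {ys} → Unique (xs ++ ys) → Unique ys
  unique-suffix [] u = u
  unique-suffix (x ∷ xs) (_ ∷ u) = unique-suffix xs u

  path-suffix : ∀ {x y z} (p : W x y) (q : W y z) → IsPath (p ++ʷ q) → IsPath q
  path-suffix p q u = unique-suffix (init-vertices p) (subst Unique (vertices-++ p q) u)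

  path-cons : ∀ {x y z} (e : E x y) (p : W y z) → IsPath p → x ∉ᴸ vertices p → IsPath (step e p)
  path-cons e p up x∉ = ¬Any⇒All¬ (vertices p) x∉ ∷ up

  vertices-length : ∀ {x y} (p : W x y) → length (vertices p) ≡ suc (len p)
  vertices-length (here x) = refl
  vertices-length (step e p) = cong suc (vertices-length p)

  path-length : ∀ {x y} (p : W x y) → IsPath p → d x y ≡ len p
  path-length {x} {y} p up = suc-injective (begin
    suc (d x y)               ≡⟨ sym (vertices-length P) ⟩
    length (vertices P)       ≡⟨ cong length (uniq x y P p (proj₂ (conn x y)) up) ⟩
    length (vertices p)       ≡⟨ vertices-length p ⟩
    suc (len p)               ∎)
    where
    open ≡-Reasoning
    P : W x y
    P = proj₁ (conn x y)

  dist≡0 : ∀ {x y} → d x y ≡ 0 → x ≡ y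
  dist≡0 {x} {y} = empty (proj₁ (conn x y))
    where
    empty : ∀ {x y} (p : W x y) → len p ≡ 0 → x ≡ y
    empty (here x) _ = refl
    empty (step e p) ()

  dist-refl : ∀ x → d x x ≡ 0
  dist-refl x = path-length (here x) ([] ∷ [])

  -- Across an edge v–u the distances to any vertex x differ by exactly
  -- one: the path from v to x either passes through u or it does not.
  edge-dist : ∀ {v u} x → E v u → (d u x ≡ suc (d v x)) ⊎ (d v x ≡ suc (d u x))
  edge-dist {v} {u} x e = cases (u ∈ᴸ? vertices P)
    where
    P : W v x
    P = proj₁ (conn v x)

    through-u : ∀ {x} (Q : W v x) → IsPath Q → u ∈ᴸ vertices Q → d v x ≡ suc (d u x)
    through-u (here _) _ (hd refl) = ⊥-elim (edge-irrefl e)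
    through-u (step e' Q') _ (hd refl) = ⊥-elim (edge-irrefl e)
    through-u (step e' Q') (v∉Q' ∷ uQ') (tl m) with split Q' m
    ... | Q₁ , Q₂ , refl =
        trans (path-length (step e Q₂) (path-cons e Q₂ uQ₂ v∉Q₂)) (cong suc (sym (path-length Q₂ uQ₂)))
      where
      uQ₂ : IsPath Q₂
      uQ₂ = path-suffix Q₁ Q₂ uQ'
      v∉Q₂ : v ∉ᴸ vertices Q₂
      v∉Q₂ m₂ = All.lookup v∉Q' (∈-++ʷ⁺ʳ Q₁ Q₂ m₂) refl

    cases : Dec (u ∈ᴸ vertices P) → (d u x ≡ suc (d v x)) ⊎ (d v x ≡ suc (d u x))
    cases (no u∉) = inj₁ (path-length (step (edge-sym e) P) (path-cons (edge-sym e) P (proj₂ (conn v x)) u∉))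
    cases (yes u∈) = inj₂ (through-u P (proj₂ (conn v x)) u∈)

  dist≤len : ∀ {x y} (p : W x y) → d x y ≤ len p
  dist≤len (here x) = ≤-reflexive (dist-refl x)
  dist≤len {y = y} (step e p) = ≤-trans (edge-≤ (edge-dist y e)) (s≤s (dist≤len p))
    where
    edge-≤ : ∀ {a b} → (b ≡ suc a) ⊎ (a ≡ suc b) → a ≤ suc b
    edge-≤ (inj₁ refl) = ≤-trans (n≤1+n _) (n≤1+n _)
    edge-≤ (inj₂ refl) = ≤-refl

  dist-triangle : ∀ a b c → d a c ≤ d a b + d b c
  dist-triangle a b c = ≤-trans (dist≤len (P ++ʷ Q)) (≤-reflexive (len-++ P Q))
    where P = proj₁ (conn a b) ; Q = proj₁ (conn b c)

  dist-sym : ∀ x y → d x y ≡ d y x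
  dist-sym x y = ≤-antisym (reversed y x) (reversed x y)
    where
    reversed : ∀ a b → d b a ≤ d a b
    reversed a b = ≤-trans (dist≤len (reverse (proj₁ (conn a b))))
                           (≤-reflexive (len-reverse (proj₁ (conn a b))))

  dist-edge : ∀ {x y} → E x y → d x y ≡ 1
  dist-edge {x} {y} e = ≤-antisym (dist≤len (step e (here y))) (n≢0⇒n>0 (λ eq → edge⇒≢ e (dist≡0 eq)))

  -- Such a neighbour exists when z ≢ t, and it is
  -- unique (it is the second vertex of the path from z to t).

  Toward : Fin n → Fin n → Fin n → Set
  Toward z w t = E z w × d w t < d z t

  toward : ∀ {x t} → x ≢ t → Σ (Fin n) λ w → Toward x w t
  toward {x} {t} x≢t = first-step (proj₁ (conn x t)) refl
    where
    first-step : (P : W x t) → d x t ≡ len P → Σ (Fin n) λ w → Toward x w t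
    first-step (here _) _ = ⊥-elim (x≢t refl)
    first-step (step {y = w} e P') eq = w , e , ≤-trans (s≤s (dist≤len P')) (≤-reflexive (sym eq))

  farther∉path : ∀ {v u x} → d u x < d v x → (Q : W u x) → d u x ≡ len Q → v ∉ᴸ vertices Q
  farther∉path {v} {u} {x} lt Q eq m with split Q m
  ... | Q₁ , Q₂ , refl = <-irrefl refl (begin-strict
    d u x                 <⟨ lt ⟩
    d v x                 ≤⟨ dist≤len Q₂ ⟩
    len Q₂                ≤⟨ m≤n+m (len Q₂) (len Q₁) ⟩
    len Q₁ + len Q₂       ≡⟨ sym (len-++ Q₁ Q₂) ⟩
    len (Q₁ ++ʷ Q₂)       ≡⟨ sym eq ⟩
    d u x                 ∎)
    where open ≤-Reasoning

  vertices-start : ∀ {a b} (p : W a b) → Σ (List (Fin n)) λ xs → vertices p ≡ a ∷ xs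
  vertices-start (here a) = [] , refl
  vertices-start (step e p) = vertices p , refl

  toward-unique : ∀ {v u u' x} → Toward v u x → Toward v u' x → u ≡ u'
  toward-unique {v} {u} {u'} {x} (e , lt) (e' , lt') =
    ∷-injectiveˡ (trans (sym (proj₂ (vertices-start Q)))
                 (trans (∷-injectiveʳ same-path) (proj₂ (vertices-start Q'))))
    where
    Q = proj₁ (conn u x)
    Q' = proj₁ (conn u' x)
    -- v followed by the path from u (resp. u') to x is a path from v to x
    same-path : vertices (step e Q) ≡ vertices (step e' Q')
    same-path = uniq v x (step e Q) (step e' Q')
      (path-cons e Q (proj₂ (conn u x)) (farther∉path lt Q refl))
      (path-cons e' Q' (proj₂ (conn u' x)) (farther∉path lt' Q' refl))

  dist-neighbour : ∀ a {z z'} → E z z' → d a z' ≤ suc (d a z)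
  dist-neighbour a {z} {z'} e =
    ≤-trans (dist-triangle a z z') (≤-reflexive (trans (cong (d a z +_) (dist-edge e)) (+-comm (d a z) 1)))

  closer-by-one : ∀ {z w} x → E z w → d w x < d z x → d z x ≡ suc (d w x)
  closer-by-one x e lt with edge-dist x e
  ... | inj₁ eq = ⊥-elim (<-asym lt (≤-reflexive (sym eq)))
  ... | inj₂ eq = eq

  -- Branches.  Br v u x says that x lies in the component of T - v
  -- containing u.  For an edge v–u this is characterised metrically:
  -- Br v u x  iff  d u x < d v x.

  Br : Fin n → Fin n → Fin n → Set
  Br = InComp G

  -- Walking from z straight toward x never visits a vertex farther from x.
  closer⇒branch : ∀ {v z x} → d z x < d v x → Br v z x
  closer⇒branch {v} {z} {x} = descend (d z x) z refl
    where
    descend : ∀ k z → d z x ≡ k → d z x < d v x → Br v z x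
    descend zero z eq lt with dist≡0 eq
    ... | refl = here x , λ { (hd refl) → <-irrefl refl lt }
    descend (suc k) z eq lt with toward {z} {x} (λ { refl → 0≢1+n (trans (sym (dist-refl x)) eq) })
    ... | w , e , w-closer with descend k w (suc-injective (trans (sym (closer-by-one x e w-closer)) eq))
                                            (<-trans w-closer lt)
    ...   | p , v∉p = step e p , λ { (hd refl) → <-irrefl refl lt ; (tl m) → v∉p m }

  -- Being closer to u than to v (v–u an edge) is inherited by every
  -- neighbour other than v: otherwise z would have two distinct
  -- neighbours toward v.
  stays-closer : ∀ {v u z z'} → E v u → d u z < d v z → E z z' → z' ≢ v → d u z' < d v z'
  stays-closer {v} {u} {z} {z'} e closer ez z'≢v with edge-dist z' e
  ... | inj₂ eq = ≤-reflexive (sym eq)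
  ... | inj₁ u-farther = ⊥-elim (contradiction (u ≟ᶠ z))
    where
    vz : d v z ≡ suc (d u z)
    vz = closer-by-one z e closer

    vz' : d v z' ≡ d u z
    vz' = ≤-antisym (≤-pred (≤-trans (≤-reflexive (sym u-farther)) (dist-neighbour u ez)))
                    (≤-pred (≤-trans (≤-reflexive (sym vz)) (dist-neighbour v (edge-sym ez))))

    z'-toward-v : Toward z z' v
    z'-toward-v = ez , (begin-strict
      d z' v         ≡⟨ trans (dist-sym z' v) vz' ⟩
      d u z          <⟨ n<1+n (d u z) ⟩
      suc (d u z)    ≡⟨ sym (trans (dist-sym z v) vz) ⟩
      d z v          ∎)
      where open ≤-Reasoning

    contradiction : Dec (u ≡ z) → ⊥
    contradiction (yes refl) = z'≢v (sym (dist≡0 (trans vz' (dist-refl u))))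
    contradiction (no u≢z) with toward {z} {u} (λ eq → u≢z (sym eq))
    ... | w , ew , w-closer = <-irrefl refl (begin-strict
        d z u          <⟨ n<1+n (d z u) ⟩
        suc (d z u)    ≡⟨ cong suc (trans (dist-sym z u) (sym vz')) ⟩
        suc (d v z')   ≡⟨ sym (trans (dist-sym z' u) u-farther) ⟩
        d z' u         ≡⟨ cong (λ t → d t u) (sym w≡z') ⟩
        d w u          <⟨ w-closer ⟩
        d z u          ∎)
      where
      open ≤-Reasoning
      w≡z' : w ≡ z'
      w≡z' = toward-unique (ew , (begin-strict
        d w v          ≤⟨ dist-neighbour w (edge-sym e) ⟩
        suc (d w u)    <⟨ s≤s w-closer ⟩
        suc (d z u)    ≡⟨ cong suc (dist-sym z u) ⟩
        suc (d u z)    ≡⟨ sym (trans (dist-sym z v) vz) ⟩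
        d z v          ∎)) z'-toward-v

  branch⇒closer : ∀ {v u x} → E v u → Br v u x → d u x < d v x
  branch⇒closer {v} {u} e (p , v∉p) = along p v∉p u-closer
    where
    u-closer : d u u < d v u
    u-closer = ≤-reflexive (trans (cong suc (dist-refl u)) (sym (dist-edge e)))

    along : ∀ {z x} (p : W z x) → v ∉ᴸ vertices p → d u z < d v z → d u x < d v x
    along (here _) _ c = c
    along (step ez p) v∉ c =
      along p (λ m → v∉ (tl m)) (stays-closer e c ez (λ { refl → v∉ (tl (start∈ p)) }))

  branch-dist : ∀ {v u x} → E v u → Br v u x → d v x ≡ suc (d u x)
  branch-dist e c = closer-by-one _ e (branch⇒closer e c)

  toward⇒branch : ∀ {v u x} → Toward v u x → Br v u x
  toward⇒branch (_ , lt) = closer⇒branch lt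

  neighbour∈branch : ∀ {v u} → E v u → Br v u u
  neighbour∈branch e = here _ , λ { (hd refl) → edge-irrefl e }

  root∉branch : ∀ {v u} → E v u → ¬ Br v u v
  root∉branch e c = 0≢1+n (trans (sym (dist-refl _)) (branch-dist e c))

  branch-adjacent : ∀ {m b y} → E m b → Br m b y → d m y ≡ 1 → y ≡ b
  branch-adjacent eb cy eq = sym (dist≡0 (suc-injective (trans (sym (branch-dist eb cy)) eq)))

  ¬toward-root : ∀ {p q x} → E p q → Br p q x → ¬ Toward q p x
  ¬toward-root e c (_ , lt) = <-asym (branch⇒closer e c) lt

  branch⇒toward-unique : ∀ {v u u' x} → E v u → Br v u x → Toward v u' x → u ≡ u'
  branch⇒toward-unique e c tw = toward-unique (e , branch⇒closer e c) tw

  branch-extend : ∀ {v u y x} → Br v u y → (p : W y x) → v ∉ᴸ vertices p → Br v u x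
  branch-extend (q , v∉q) p v∉p = (q ++ʷ p) , λ m → Sum.[ v∉q , v∉p ] (∈-++ʷ⁻ q p m)

  walk-in-branch : ∀ {z w x t} (p : W w x) → z ∉ᴸ vertices p → t ∈ᴸ vertices p → Br z w t
  walk-in-branch p z∉ m with split p m
  ... | p₁ , p₂ , refl = p₁ , λ m₁ → z∉ (∈-++ʷ⁺ˡ p₁ p₂ m₁)

  branch-nested : ∀ {R u z w} → Br R u z → E z w → ¬ Br z w R → ∀ x → Br z w x → Br R u x
  branch-nested (q , R∉q) e R∉ x (p , z∉p) =
    branch-extend (q , R∉q) (step e p) λ { (hd refl) → R∉q (end∈ q) ; (tl m) → R∉ (walk-in-branch p z∉p m) }

  branch-step-⊆ : ∀ {p q q'} → E p q → E q q' → q' ≢ p → ∀ x → Br q q' x → Br p q x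
  branch-step-⊆ {p} {q} {q'} e e' q'≢p x c with edge-dist x e
  ... | inj₁ eq = ⊥-elim (q'≢p (branch⇒toward-unique e' c (edge-sym e , ≤-reflexive (sym eq))))
  ... | inj₂ eq = closer⇒branch (≤-reflexive (sym eq))

  branch-back-⊆ : ∀ {p q q'} → E p q → E q q' → q' ≢ p → ∀ x → Br q p x → Br q' q x
  branch-back-⊆ {p} {q} {q'} e e' q'≢p x c with edge-dist x e'
  ... | inj₁ eq = closer⇒branch (≤-reflexive (sym eq))
  ... | inj₂ eq = ⊥-elim (q'≢p (sym (branch⇒toward-unique (edge-sym e) c (e' , ≤-reflexive (sym eq)))))

  dist-through-cut : ∀ {z w a b} → E z w → Br z w a → ¬ Br z w b → d a z + d z b ≤ d a b
  dist-through-cut {z} {w} {a} {b} e (q , z∉q) b∉ with z ∈ᴸ? vertices (proj₁ (conn a b))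
  ... | no z∉ = ⊥-elim (b∉ (branch-extend (q , z∉q) (proj₁ (conn a b)) z∉))
  ... | yes z∈ with split (proj₁ (conn a b)) z∈
  ...   | p₁ , p₂ , eq = begin
      d a z + d z b       ≤⟨ +-mono-≤ (dist≤len p₁) (dist≤len p₂) ⟩
      len p₁ + len p₂     ≡⟨ sym (len-++ p₁ p₂) ⟩
      len (p₁ ++ʷ p₂)     ≡⟨ cong len eq ⟩
      d a b               ∎
    where open ≤-Reasoning

  separates-across : ∀ {m a b x y τ} → E m a → E m b → a ≢ b → Br m a x → Br m b y →
                     d m x ≡ d m y → Br m a τ → d x τ < d y τ
  separates-across {m} {a} {b} {x} {y} {τ} ea eb a≢b cx cy mx≡my cτ = begin-strict
    d x τ              ≤⟨ dist-triangle x a τ ⟩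
    d x a + d a τ      ≡⟨ cong (_+ d a τ) (dist-sym x a) ⟩
    d a x + d a τ      <⟨ +-monoˡ-< (d a τ) (branch⇒closer ea cx) ⟩
    d m x + d a τ      <⟨ +-monoʳ-< (d m x) (branch⇒closer ea cτ) ⟩
    d m x + d m τ      ≡⟨ cong (_+ d m τ) (trans mx≡my (dist-sym m y)) ⟩
    d y m + d m τ      ≤⟨ dist-through-cut eb cy τ∉b ⟩
    d y τ              ∎
    where
    open ≤-Reasoning
    τ∉b : ¬ Br m b τ
    τ∉b c = a≢b (branch⇒toward-unique ea cτ (eb , branch⇒closer eb c))

  -- Parity.  Trees are bipartite: d x τ + d y τ has the parity of any
  -- walk between x and y, so if d x y is odd every vertex separates x, y.

  data Even : ℕ → Set where
    even-zero : Even 0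
    even-ss   : ∀ {k} → Even k → Even (suc (suc k))

  even? : ∀ k → Dec (Even k)
  even? zero = yes even-zero
  even? (suc zero) = no λ ()
  even? (suc (suc k)) with even? k
  ... | yes e = yes (even-ss e)
  ... | no ¬e = no λ { (even-ss e) → ¬e e }

  even-double : ∀ k → Even (k + k)
  even-double zero = even-zero
  even-double (suc k) = subst Even (cong suc (sym (+-suc k k))) (even-ss (even-double k))

  even-half : ∀ {l} → Even l → Σ ℕ λ h → l ≡ h + h
  even-half even-zero = 0 , refl
  even-half (even-ss e) with even-half e
  ... | h , refl = suc h , cong suc (sym (+-suc h h))

  even-cancel : ∀ k l → Even (k + l + k) → Even l
  even-cancel zero l e = subst Even (+-identityʳ l) e
  even-cancel (suc k) l e with subst Even (cong suc (+-suc (k + l) k)) e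
  ... | even-ss e' = even-cancel k l e'

  walk-parity : ∀ {x y} τ (p : W x y) → Even (d x τ + len p + d y τ)
  walk-parity {x} τ (here x) = subst Even (cong (_+ d x τ) (sym (+-identityʳ (d x τ)))) (even-double (d x τ))
  walk-parity {x} {y} τ (step {y = x'} e p) with edge-dist τ e | walk-parity τ p
  ... | inj₁ eq | ih = subst Even (cong (_+ d y τ) (sym (+-suc (d x τ) (len p))))
                         (subst Even (cong (λ r → r + len p + d y τ) eq) ih)
  ... | inj₂ eq | ih = subst Even (cong (λ r → r + suc (len p) + d y τ) (sym eq))
                         (subst Even (cong (λ r → suc r + d y τ) (sym (+-suc (d x' τ) (len p)))) (even-ss ih))

  odd-distance-separates : ∀ {x y} → ¬ Even (d x y) → ∀ τ → d x τ ≢ d y τ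
  odd-distance-separates {x} {y} odd τ eq = odd (even-cancel (d x τ) (d x y)
    (subst (λ r → Even (d x τ + d x y + r)) (sym eq) (walk-parity τ (proj₁ (conn x y)))))

  midpoint : ∀ x y h → d x y ≡ h + h → Σ (Fin n) λ m → (d x m ≡ h) × (d m y ≡ h)
  midpoint x y h eq with splitAt (proj₁ (conn x y)) h (≤-trans (m≤m+n h h) (≤-reflexive (sym eq)))
  ... | z , p₁ , p₂ , len₁ , len₁₂ = z , ≤-antisym xz≤h h≤xz , ≤-antisym zy≤h h≤zy
    where
    len₂ : len p₂ ≡ h
    len₂ = +-cancelˡ-≡ h _ _ (trans (cong (_+ len p₂) (sym len₁)) (trans len₁₂ eq))
    xz≤h : d x z ≤ h
    xz≤h = ≤-trans (dist≤len p₁) (≤-reflexive len₁)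
    zy≤h : d z y ≤ h
    zy≤h = ≤-trans (dist≤len p₂) (≤-reflexive len₂)
    h+h≤ : h + h ≤ d x z + d z y
    h+h≤ = ≤-trans (≤-reflexive (sym eq)) (dist-triangle x z y)
    h≤xz : h ≤ d x z
    h≤xz = +-cancelʳ-≤ h _ _ (≤-trans h+h≤ (+-monoʳ-≤ (d x z) zy≤h))
    h≤zy : h ≤ d z y
    h≤zy = +-cancelˡ-≤ h _ _ (≤-trans h+h≤ (+-monoˡ-≤ (d z y) xz≤h))

  record Fork (x y : Fin n) : Set where
    constructor fork
    field
      m a b       : Fin n
      ma          : E m a
      mb          : E m b
      a≢b         : a ≢ b
      x∈a         : Br m a x
      y∈b         : Br m b y
      equidistant : d m x ≡ d m y

  even-distance-fork : ∀ {x y} → x ≢ y → Even (d x y) → Fork x y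
  even-distance-fork {x} {y} x≢y ev with even-half ev
  ... | h , xy≡h+h with midpoint x y h xy≡h+h
  ...   | m , xm≡h , my≡h with toward {m} {x} m≢x | toward {m} {y} m≢y
    where
    h≢0 : h ≢ 0
    h≢0 refl = x≢y (dist≡0 xy≡h+h)
    m≢x : m ≢ x
    m≢x refl = h≢0 (trans (sym xm≡h) (dist-refl m))
    m≢y : m ≢ y
    m≢y refl = h≢0 (trans (sym my≡h) (dist-refl m))
  ...     | a , ta | b , tb =
    fork m a b (proj₁ ta) (proj₁ tb) a≢b (toward⇒branch ta) (toward⇒branch tb) (trans mx≡h (sym my≡h))
    where
    mx≡h : d m x ≡ h
    mx≡h = trans (dist-sym m x) xm≡h
    -- if a ≡ b, the walk x–a–y would be shorter than d x y
    a≢b : a ≢ b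
    a≢b refl = <-irrefl refl (begin-strict
      d x y                  ≤⟨ dist-triangle x a y ⟩
      d x a + d a y          ≡⟨ cong (_+ d a y) (dist-sym x a) ⟩
      d a x + d a y          <⟨ +-monoˡ-< (d a y) (proj₂ ta) ⟩
      d m x + d a y          <⟨ +-monoʳ-< (d m x) (proj₂ tb) ⟩
      d m x + d m y          ≡⟨ cong₂ _+_ mx≡h my≡h ⟩
      h + h                  ≡⟨ sym xy≡h+h ⟩
      d x y                  ∎)
      where open ≤-Reasoning

  -- Degrees.  deg v is the length of the duplicate-free list of
  -- neighbours of v, so it bounds the size of any duplicate-free list of
  -- neighbours, and a list shorter than deg v misses some neighbour.

  private
    remove : ∀ {y} (ys : List (Fin n)) → y ∈ᴸ ys → List (Fin n)
    remove (_ ∷ ys) (hd _) = ys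
    remove (z ∷ ys) (tl m) = z ∷ remove ys m

    length-remove : ∀ {y} ys (m : y ∈ᴸ ys) → length ys ≡ suc (length (remove ys m))
    length-remove (_ ∷ ys) (hd _) = refl
    length-remove (z ∷ ys) (tl m) = cong suc (length-remove ys m)

    ∈-remove : ∀ {y t} ys (m : y ∈ᴸ ys) → t ∈ᴸ ys → t ≢ y → t ∈ᴸ remove ys m
    ∈-remove (_ ∷ ys) (hd refl) (hd refl) t≢y = ⊥-elim (t≢y refl)
    ∈-remove (_ ∷ ys) (hd refl) (tl mt) t≢y = mt
    ∈-remove (z ∷ ys) (tl m) (hd refl) t≢y = hd refl
    ∈-remove (z ∷ ys) (tl m) (tl mt) t≢y = tl (∈-remove ys m mt t≢y)

  unique-⊆-length : ∀ (ds ys : List (Fin n)) → Unique ds → All (_∈ᴸ ys) ds → length ds ≤ length ys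
  unique-⊆-length [] ys _ _ = z≤n
  unique-⊆-length (x ∷ ds) ys (x∉ds ∷ uds) (x∈ys ∷ ds⊆ys) =
    ≤-trans (s≤s (unique-⊆-length ds (remove ys x∈ys) uds (still-in x∉ds ds⊆ys)))
            (≤-reflexive (sym (length-remove ys x∈ys)))
    where
    still-in : ∀ {zs} → All (x ≢_) zs → All (_∈ᴸ ys) zs → All (_∈ᴸ remove ys x∈ys) zs
    still-in [] [] = []
    still-in (x≢z ∷ ns) (z∈ys ∷ ms) = ∈-remove ys x∈ys z∈ys (λ eq → x≢z (sym eq)) ∷ still-in ns ms

  neighbours : Fin n → List (Fin n)
  neighbours v = filter (λ u → T? (adj v u)) (allFin n)

  ∈-neighbours : ∀ {v u} → E v u → u ∈ᴸ neighbours v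
  ∈-neighbours {v} {u} e = ∈-filter⁺ (λ u → T? (adj v u)) (∈-allFin u) e

  neighbours-unique : ∀ v → Unique (neighbours v)
  neighbours-unique v = Unique.filter⁺ (λ u → T? (adj v u)) {xs = allFin n} (Unique.allFin⁺ n)

  distinct-neighbours≤deg : ∀ {v} (ds : List (Fin n)) → Unique ds → All (E v) ds → length ds ≤ deg G v
  distinct-neighbours≤deg {v} ds uds es = unique-⊆-length ds (neighbours v) uds (All.map ∈-neighbours es)

  three-neighbours⇒core : ∀ {v a b c} → E v a → E v b → E v c → a ≢ b → a ≢ c → b ≢ c → Core G v
  three-neighbours⇒core ea eb ec ab ac bc =
    distinct-neighbours≤deg (_ ∷ _ ∷ _ ∷ []) ((ab ∷ ac ∷ []) ∷ (bc ∷ []) ∷ [] ∷ []) (ea ∷ eb ∷ ec ∷ [])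

  four-neighbours⇒4≤deg : ∀ {v a b c e} → E v a → E v b → E v c → E v e →
                          a ≢ b → a ≢ c → a ≢ e → b ≢ c → b ≢ e → c ≢ e → 4 ≤ deg G v
  four-neighbours⇒4≤deg ea eb ec ee ab ac ae bc be ce =
    distinct-neighbours≤deg (_ ∷ _ ∷ _ ∷ _ ∷ [])
      ((ab ∷ ac ∷ ae ∷ []) ∷ (bc ∷ be ∷ []) ∷ (ce ∷ []) ∷ [] ∷ []) (ea ∷ eb ∷ ec ∷ ee ∷ [])

  fresh-neighbour : ∀ {v} (bs : List (Fin n)) → length bs < deg G v → Σ (Fin n) λ u → E v u × u ∉ᴸ bs
  fresh-neighbour {v} bs short with Any.any? (λ t → ¬? (t ∈ᴸ? bs)) (neighbours v)
  ... | yes found = let (u , u∈ , u∉bs) = find found in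
    u , proj₂ (∈-filter⁻ (λ u → T? (adj v u)) {xs = allFin n} u∈) , u∉bs
  ... | no none = ⊥-elim (<-irrefl refl (≤-trans short
    (unique-⊆-length (neighbours v) bs (neighbours-unique v)
      (All.map (λ {t} ¬∉ → decidable-stable (t ∈ᴸ? bs) ¬∉) (¬Any⇒All¬ (neighbours v) none)))))

  degree-3-neighbours : ∀ {v a b c w} → deg G v ≡ 3 → E v a → E v b → E v c → a ≢ b → a ≢ c → b ≢ c →
                        E v w → w ≡ a ⊎ w ≡ b ⊎ w ≡ c
  degree-3-neighbours {v} {a} {b} {c} {w} deg≡3 ea eb ec ab ac bc ew with w ≟ᶠ a | w ≟ᶠ b | w ≟ᶠ c
  ... | yes p | _ | _ = inj₁ p
  ... | no _ | yes p | _ = inj₂ (inj₁ p)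
  ... | no _ | no _ | yes p = inj₂ (inj₂ p)
  ... | no wa | no wb | no wc = ⊥-elim (<-irrefl refl (≤-trans
          (four-neighbours⇒4≤deg ea eb ec ew ab ac (≢-sym wa) bc (≢-sym wb) (≢-sym wc)) (≤-reflexive deg≡3)))

  -- Decidability of the tree notions (all quantifiers range over Fin n).

  edge? : ∀ x y → Dec (E x y)
  edge? x y = T? (adj x y)

  branch? : ∀ {v u} → E v u → ∀ x → Dec (Br v u x)
  branch? {v} {u} e x with d u x <? d v x
  ... | yes lt = yes (closer⇒branch lt)
  ... | no ¬lt = no λ c → ¬lt (branch⇒closer e c)

  core? : ∀ v → Dec (Core G v)
  core? v = 3 ≤? deg G v

  leg? : ∀ v u → Dec (IsLeg G v u)
  leg? v u with edge? v u
  ... | no ¬e = no (λ l → ¬e (proj₁ l))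
  ... | yes e = Dec.map′ (e ,_) proj₂ (Fin.all? (λ x → branch? e x →-dec ¬? (core? x)))

  short-leg? : ∀ v u → Dec (ShortLeg G v u)
  short-leg? v u with leg? v u
  ... | no ¬l = no (λ s → ¬l (proj₁ s))
  ... | yes l = Dec.map′ (l ,_) proj₂ (Fin.all? (λ x → branch? (proj₁ l) x →-dec (x ≟ᶠ u)))

  small-core? : ∀ w → Dec (SmallCore G w)
  small-core? w = (deg G w ≟ 3) ×-dec
    Fin.any? (λ u₁ → Fin.any? (λ u₂ → ¬? (u₁ ≟ᶠ u₂) ×-dec (leg? w u₁ ×-dec short-leg? w u₂)))

  regular-core? : ∀ v → Dec (RegularCore G v)
  regular-core? v = core? v ×-dec ¬? (small-core? v)

  small-of : ∀ {v} → Core G v → ¬ RegularCore G v → SmallCore G v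
  small-of {v} c ¬reg = decidable-stable (small-core? v) (λ ¬small → ¬reg (c , ¬small))

  HasRegular : Fin n → Fin n → Set
  HasRegular v u = Σ (Fin n) λ z → Br v u z × RegularCore G z

  has-regular? : ∀ {v u} → E v u → Dec (HasRegular v u)
  has-regular? e = Fin.any? (λ z → branch? e z ×-dec regular-core? z)

  -- Branch size, the measure for all recursions over nested branches.
  module _ {P Q : Fin n → Set} (P? : ∀ x → Dec (P x)) (Q? : ∀ x → Dec (Q x)) (P⊆Q : ∀ x → P x → Q x) where
    filter-length-≤ : ∀ xs → length (filter P? xs) ≤ length (filter Q? xs)
    filter-length-≤ [] = z≤n
    filter-length-≤ (x ∷ xs) with P? x | Q? x
    ... | yes p | yes q = s≤s (filter-length-≤ xs)
    ... | yes p | no ¬q = ⊥-elim (¬q (P⊆Q x p))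
    ... | no ¬p | yes q = m≤n⇒m≤1+n (filter-length-≤ xs)
    ... | no ¬p | no ¬q = filter-length-≤ xs

    filter-length-< : ∀ {a} xs → a ∈ᴸ xs → ¬ P a → Q a → length (filter P? xs) < length (filter Q? xs)
    filter-length-< (x ∷ xs) m ¬pa qa with P? x | Q? x
    filter-length-< (x ∷ xs) (hd refl) ¬pa qa | yes p | _ = ⊥-elim (¬pa p)
    filter-length-< (x ∷ xs) (hd refl) ¬pa qa | no ¬p | yes q = s≤s (filter-length-≤ xs)
    filter-length-< (x ∷ xs) (hd refl) ¬pa qa | no ¬p | no ¬q = ⊥-elim (¬q qa)
    filter-length-< (x ∷ xs) (tl m) ¬pa qa | yes p | yes q = s≤s (filter-length-< xs m ¬pa qa)
    filter-length-< (x ∷ xs) (tl m) ¬pa qa | yes p | no ¬q = ⊥-elim (¬q (P⊆Q x p))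
    filter-length-< (x ∷ xs) (tl m) ¬pa qa | no ¬p | yes q = m≤n⇒m≤1+n (filter-length-< xs m ¬pa qa)
    filter-length-< (x ∷ xs) (tl m) ¬pa qa | no ¬p | no ¬q = filter-length-< xs m ¬pa qa

  size : Fin n → Fin n → ℕ
  size v u = length (filter (λ x → d u x <? d v x) (allFin n))

  size-< : ∀ {v u v' u'} → E v u → E v' u' → (∀ x → Br v' u' x → Br v u x) →
           ∀ a → Br v u a → ¬ Br v' u' a → size v' u' < size v u
  size-< {v} {u} {v'} {u'} e e' ⊆ a a∈ a∉ =
    filter-length-< (λ x → d u' x <? d v' x) (λ x → d u x <? d v x)
      (λ x lt → branch⇒closer e (⊆ x (closer⇒branch lt)))
      (allFin n) (∈-allFin a) (λ lt → a∉ (closer⇒branch lt)) (branch⇒closer e a∈)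

  -- If q is a small core and the side of p contains a core, then q is the
  -- only core of the branch of p at q: its other two branches are legs.
  small-core-alone : ∀ {p q c} → E p q → Br q p c → Core G c → SmallCore G q →
                     ∀ x → Br p q x → Core G x → x ≡ q
  small-core-alone {p} {q} {c} e c∈ core-c (q-deg3 , u₁ , u₂ , u₁≢u₂ , leg₁ , short₂) x x∈ core-x
    with x ≟ᶠ q
  ... | yes x≡q = x≡q
  ... | no x≢q with toward {q} {x} (≢-sym x≢q)
  ...   | w , tw with degree-3-neighbours q-deg3 (edge-sym e) (proj₁ leg₁) (proj₁ (proj₁ short₂))
                        p≢u₁ p≢u₂ u₁≢u₂ (proj₁ tw)
    where
    p≢u₁ : p ≢ u₁
    p≢u₁ refl = proj₂ leg₁ c c∈ core-c
    p≢u₂ : p ≢ u₂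
    p≢u₂ refl = proj₂ (proj₁ short₂) c c∈ core-c
  ...     | inj₁ refl = ⊥-elim (¬toward-root e x∈ tw)
  ...     | inj₂ (inj₁ refl) = ⊥-elim (proj₂ leg₁ x (toward⇒branch tw) core-x)
  ...     | inj₂ (inj₂ refl) = ⊥-elim (proj₂ (proj₁ short₂) x (toward⇒branch tw) core-x)

  through-non-core : ∀ {p q q'} → E p q → E q q' → q' ≢ p → ¬ Core G q →
                     ∀ x → Br p q x → x ≢ q → Br q q' x
  through-non-core {p} {q} {q'} e e' q'≢p ¬core x x∈ x≢q with toward {q} {x} (≢-sym x≢q)
  ... | w , tw with w ≟ᶠ p | w ≟ᶠ q'
  ...   | yes refl | _ = ⊥-elim (¬toward-root e x∈ tw)
  ...   | no _ | yes refl = toward⇒branch tw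
  ...   | no w≢p | no w≢q' =
    ⊥-elim (¬core (three-neighbours⇒core (edge-sym e) e' (proj₁ tw) (≢-sym q'≢p) (≢-sym w≢p) (≢-sym w≢q')))

  extend-gleg : ∀ {p q q'} → E p q → E q q' → q' ≢ p → ¬ Core G q → GLeg G q q' → GLeg G p q
  extend-gleg {p} {q} {q'} e e' q'≢p ¬core (inj₁ (_ , no-core)) = inj₁ (e , no-core')
    where
    no-core' : ∀ x → Br p q x → ¬ Core G x
    no-core' x x∈ core-x with x ≟ᶠ q
    ... | yes refl = ¬core core-x
    ... | no x≢q = no-core x (through-non-core e e' q'≢p ¬core x x∈ x≢q) core-x
  extend-gleg {p} {q} {q'} e e' q'≢p ¬core (inj₂ (w , _ , w∈ , small-w , only-w)) =
    inj₂ (w , e , branch-step-⊆ e e' q'≢p w w∈ , small-w , only-w')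
    where
    only-w' : ∀ x → Br p q x → Core G x → x ≡ w
    only-w' x x∈ core-x with x ≟ᶠ q
    ... | yes refl = ⊥-elim (¬core core-x)
    ... | no x≢q = only-w x (through-non-core e e' q'≢p ¬core x x∈ x≢q) core-x

  no-regular⇒gleg : ∀ (k : ℕ) {p q} → size p q < k → E p q → (∀ z → Br p q z → ¬ RegularCore G z) →
                    (Σ (Fin n) λ c → Br q p c × Core G c) → GLeg G p q
  no-regular⇒gleg (suc k) {p} {q} size<k e no-reg (c , c∈ , core-c) with core? q
  ... | yes core-q = inj₂ (q , e , neighbour∈branch e , small-q , small-core-alone e c∈ core-c small-q)
    where
    small-q : SmallCore G q
    small-q = small-of core-q (no-reg q (neighbour∈branch e))
  ... | no ¬core-q with Fin.any? (λ t → edge? q t ×-dec ¬? (t ≟ᶠ p))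
  ...   | yes (q' , e' , q'≢p) =
    extend-gleg e e' q'≢p ¬core-q
      (no-regular⇒gleg k (≤-trans (size-< e e' (branch-step-⊆ e e' q'≢p) q (neighbour∈branch e)
                                            (root∉branch e')) (≤-pred size<k))
        e' (λ z z∈ → no-reg z (branch-step-⊆ e e' q'≢p z z∈)) (c , branch-back-⊆ e e' q'≢p c c∈ , core-c))
  ...   | no leaf = inj₁ (e , λ x x∈ core-x → leaf-only x x∈ core-x (x ≟ᶠ q))
    where
    -- q is a leaf, so its branch is {q}
    leaf-only : ∀ x → Br p q x → Core G x → Dec (x ≡ q) → ⊥
    leaf-only x x∈ core-x (yes refl) = ¬core-q core-x
    leaf-only x x∈ core-x (no x≢q) with toward {q} {x} (≢-sym x≢q)
    ... | w , tw with w ≟ᶠ p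
    ...   | yes refl = ¬toward-root e x∈ tw
    ...   | no w≢p = leaf (w , proj₁ tw , w≢p)

  branch-gleg : ∀ {p q} → E p q → ¬ HasRegular p q → Core G p → GLeg G p q
  branch-gleg e ¬reg core-p =
    no-regular⇒gleg (suc (size _ _)) ≤-refl e (λ z z∈ reg → ¬reg (z , z∈ , reg))
      (_ , neighbour∈branch (edge-sym e) , core-p)

  -- Modified legs.  Let the branch of R at u contain exactly one core m,
  -- and let c be the neighbour of m toward R.  Then the part of that
  -- branch on R's side of m is the path between R and m.

  module ModifiedLeg {R u m c : Fin n} (Ru : E R u) (m∈ : Br R u m)
                     (only-m : ∀ x → Br R u x → Core G x → x ≡ m) (mc : Toward m c R) where

    common-step : ∀ {z w} → Br R u z → Br m c z → Toward z w m → Toward z w R →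
                  w ≢ m × Br R u w × Br m c w
    common-step {z} {w} z∈u z∈c zw-m zw-R =
      w≢m , closer⇒branch (stays-closer Ru (branch⇒closer Ru z∈u) (proj₁ zw-m) w≢R)
          , closer⇒branch (stays-closer (proj₁ mc) (branch⇒closer (proj₁ mc) z∈c) (proj₁ zw-m) w≢m)
      where
      w≢R : w ≢ R
      w≢R refl with branch-adjacent Ru z∈u (dist-edge (edge-sym (proj₁ zw-m)))
      ... | refl = <-asym (branch⇒closer Ru m∈) (proj₂ zw-m)
      w≢m : w ≢ m
      w≢m refl with branch-adjacent (proj₁ mc) z∈c (dist-edge (edge-sym (proj₁ zw-m)))
      ... | refl = <-asym (proj₂ zw-R) (proj₂ mc)

    -- Following common steps one reaches a vertex where the directions
    -- toward m and R split; it has three distinct neighbours, so it would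
    -- be a second core of the leg.  (Induction on d z R.)
    no-common-step : ∀ (k : ℕ) {z w} → d z R < k → Br R u z → Br m c z →
                     Toward z w m → Toward z w R → ⊥
    no-common-step (suc k) {z} {w} zR<k z∈u z∈c zw-m zw-R with common-step z∈u z∈c zw-m zw-R
    ... | w≢m , w∈u , w∈c with toward {w} {m} w≢m | toward {w} {R} (λ { refl → root∉branch Ru w∈u })
    ...   | t₁ , wt₁ | t₂ , wt₂ with t₁ ≟ᶠ t₂
    ...     | yes refl = no-common-step k (≤-trans (proj₂ zw-R) (≤-pred zR<k)) w∈u w∈c wt₁ wt₂
    ...     | no t₁≢t₂ = w≢m (only-m w w∈u
                (three-neighbours⇒core (edge-sym (proj₁ zw-m)) (proj₁ wt₁) (proj₁ wt₂) z≢t₁ z≢t₂ t₁≢t₂))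
      where
      z≢t₁ : z ≢ t₁
      z≢t₁ refl = <-asym (proj₂ zw-m) (proj₂ wt₁)
      z≢t₂ : z ≢ t₂
      z≢t₂ refl = <-asym (proj₂ zw-R) (proj₂ wt₂)

    before-core : ∀ {z} → Br R u z → Br m c z → d R z < d R m
    before-core {z} z∈u z∈c with toward {z} {m} (λ { refl → root∉branch (proj₁ mc) z∈c })
                                | toward {z} {R} (λ { refl → root∉branch Ru z∈u })
    ... | t₁ , zt₁ | t₂ , zt₂ with t₁ ≟ᶠ t₂
    ...   | yes refl = ⊥-elim (no-common-step (suc (d z R)) ≤-refl z∈u z∈c zt₁ zt₂)
    ...   | no t₁≢t₂ = begin-strict
        d R z            ≡⟨ dist-sym R z ⟩
        d z R            <⟨ +-monoˡ-≤ (d z R) 1≤mz ⟩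
        d m z + d z R    ≤⟨ dist-through-cut (proj₁ zt₁) (toward⇒branch zt₁) R∉t₁ ⟩
        d m R            ≡⟨ dist-sym m R ⟩
        d R m            ∎
      where
      open ≤-Reasoning
      1≤mz : 1 ≤ d m z
      1≤mz = ≤-trans (s≤s z≤n) (≤-reflexive (sym (branch-dist (proj₁ mc) z∈c)))
      R∉t₁ : ¬ Br z t₁ R
      R∉t₁ R∈ = t₁≢t₂ (branch⇒toward-unique (proj₁ zt₁) R∈ zt₂)

    module DegreeThree {a b : Fin n} (m-deg3 : deg G m ≡ 3) (ma : E m a) (mb : E m b)
             (a≢b : a ≢ b) (a≢c : a ≢ c) (b≢c : b ≢ c)
             (leg-a : IsLeg G m a) (leg-b : IsLeg G m b) (core-R : Core G R) where

      first-step : ∀ {z} → m ≢ z → Σ (Fin n) λ w → Toward m w z × (w ≡ a ⊎ w ≡ b ⊎ w ≡ c)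
      first-step m≢z with toward m≢z
      ... | w , tw = w , tw , degree-3-neighbours m-deg3 ma mb (proj₁ mc) a≢b a≢c b≢c (proj₁ tw)

      leg-root : ∀ {a' z} → E m a' → IsLeg G m a' → Br m a' z → d R z ≡ suc (d R m) → z ≡ a'
      leg-root {a'} {z} ma' leg z∈ Rz≡ = sym (dist≡0 (n≤0⇒n≡0 (≤-pred (begin
        suc (d a' z)           ≡⟨ sym (trans (dist-sym z m) (branch-dist ma' z∈)) ⟩
        d z m                  ≤⟨ +-cancelʳ-≤ (d m R) (d z m) 1 through-m ⟩
        1                      ∎))))
        where
        open ≤-Reasoning
        through-m : d z m + d m R ≤ 1 + d m R
        through-m = ≤-trans (dist-through-cut ma' z∈ (λ R∈ → proj₂ leg R R∈ core-R))
                            (≤-reflexive (trans (dist-sym z R) (trans Rz≡ (cong suc (dist-sym R m)))))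

      just-beyond-core : ∀ {z} → Br R u z → d R z ≡ suc (d R m) → z ≡ a ⊎ z ≡ b
      just-beyond-core {z} z∈ Rz≡ with first-step {z} (λ { refl → <-irrefl refl (≤-reflexive (sym Rz≡)) })
      ... | w , tw , inj₁ refl = inj₁ (leg-root ma leg-a (toward⇒branch tw) Rz≡)
      ... | w , tw , inj₂ (inj₁ refl) = inj₂ (leg-root mb leg-b (toward⇒branch tw) Rz≡)
      ... | w , tw , inj₂ (inj₂ refl) =
        ⊥-elim (<-irrefl refl (≤-trans (before-core z∈ (toward⇒branch tw)) (≤-trans (n≤1+n _) (≤-reflexive (sym Rz≡)))))

      far-beyond-core : ∀ {z} → Br R u z → suc (suc (d R m)) ≤ d R z → Br m a z ⊎ Br m b z
      far-beyond-core {z} z∈ far with first-step {z} (λ { refl → <-irrefl refl (≤-trans (n≤1+n _) far) })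
      ... | w , tw , inj₁ refl = inj₁ (toward⇒branch tw)
      ... | w , tw , inj₂ (inj₁ refl) = inj₂ (toward⇒branch tw)
      ... | w , tw , inj₂ (inj₂ refl) =
        ⊥-elim (<-irrefl refl (≤-trans (before-core z∈ (toward⇒branch tw)) (≤-trans (≤-trans (n≤1+n _) (n≤1+n _)) far)))

  -- A vertex with three neighbours whose branches all contain cores is a
  -- regular core: it has no leg, while a small core has one.
  cored-on-three-sides⇒regular : ∀ {w a b c} → E w a → E w b → E w c → a ≢ b → a ≢ c → b ≢ c →
    (Σ (Fin n) λ x → Br w a x × Core G x) → (Σ (Fin n) λ x → Br w b x × Core G x) →
    (Σ (Fin n) λ x → Br w c x × Core G x) → RegularCore G w
  cored-on-three-sides⇒regular wa wb wc a≢b a≢c b≢c (x , x∈ , core-x) (y , y∈ , core-y) (z , z∈ , core-z) =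
    three-neighbours⇒core wa wb wc a≢b a≢c b≢c , not-small
    where
    not-small : ¬ SmallCore G _
    not-small (w-deg3 , u , _ , _ , leg , _) with degree-3-neighbours w-deg3 wa wb wc a≢b a≢c b≢c (proj₁ leg)
    ... | inj₁ refl = proj₂ leg x x∈ core-x
    ... | inj₂ (inj₁ refl) = proj₂ leg y y∈ core-y
    ... | inj₂ (inj₂ refl) = proj₂ leg z z∈ core-z

  module SmallCoreOnModifiedLeg {m u₁ u₂ : Fin n} (m-deg3 : deg G m ≡ 3) (u₁≢u₂ : u₁ ≢ u₂)
           (leg₁ : IsLeg G m u₁) (leg₂ : IsLeg G m u₂) (¬reg-m : ¬ RegularCore G m) where

    core-m : Core G m
    core-m = ≤-reflexive (sym m-deg3)

    OnModifiedLeg : Set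
    OnModifiedLeg = Σ (Fin n) λ R → Σ (Fin n) λ u → RegularCore G R × ModLeg G R u m

    CloserRegular : Fin n → Fin n → Set
    CloserRegular R u = Σ (Fin n) λ R' → Σ (Fin n) λ u' → RegularCore G R' × Toward R' u' m × size R' u' < size R u

    advance : ∀ {R u q w} → Core G R → E R u → Br R u m → Br R u q → Toward q w m → Toward q w R →
              (Σ (Fin n) λ z → Br w q z × RegularCore G z) → w ≢ m × w ≢ R × Br R u w
    advance {R} {u} {q} {w} core-R Ru m∈ q∈ qw-m qw-R (z , z∈ , reg-z) =
      w≢m , w≢R , closer⇒branch (stays-closer Ru (branch⇒closer Ru q∈) (proj₁ qw-m) w≢R)
      where
      w≢R : w ≢ R
      w≢R refl with branch-adjacent Ru q∈ (dist-edge (edge-sym (proj₁ qw-m)))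
      ... | refl = <-asym (branch⇒closer Ru m∈) (proj₂ qw-m)
      -- otherwise m would have four neighbours: u₁, u₂, q and the one toward R
      w≢m : w ≢ m
      w≢m refl with toward {m} {R} (λ { refl → root∉branch Ru m∈ })
      ... | c , mc = <-irrefl refl (≤-trans
        (four-neighbours⇒4≤deg (proj₁ leg₁) (proj₁ leg₂) (edge-sym (proj₁ qw-m)) (proj₁ mc)
          u₁≢u₂ (λ { refl → proj₂ leg₁ z z∈ (proj₁ reg-z) }) (λ { refl → proj₂ leg₁ R (toward⇒branch mc) core-R })
          (λ { refl → proj₂ leg₂ z z∈ (proj₁ reg-z) }) (λ { refl → proj₂ leg₂ R (toward⇒branch mc) core-R })
          (λ { refl → <-asym (proj₂ qw-R) (proj₂ mc) }))
        (≤-reflexive m-deg3))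

    -- Keep advancing until the directions toward m and R split; the
    -- split vertex has cores on three sides, so it is regular.
    split-point : ∀ (k : ℕ) {R u q w} → d q m < k → Core G R → E R u → Br R u m → Br R u q →
                  Toward q w m → Toward q w R → (Σ (Fin n) λ z → Br w q z × RegularCore G z) → CloserRegular R u
    split-point (suc k) {R} {u} {q} {w} qm<k core-R Ru m∈ q∈ qw-m qw-R (z , z∈ , reg-z)
      with advance core-R Ru m∈ q∈ qw-m qw-R (z , z∈ , reg-z)
    ... | w≢m , w≢R , w∈ with toward {w} {m} w≢m | toward {w} {R} w≢R
    ...   | t₁ , wt₁ | t₂ , wt₂ with t₁ ≟ᶠ t₂
    ...     | yes refl = split-point k (≤-trans (proj₂ qw-m) (≤-pred qm<k)) core-R Ru m∈ w∈ wt₁ wt₂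
                           (z , branch-step-⊆ (edge-sym (proj₁ wt₁)) (edge-sym (proj₁ qw-m)) q≢t₁ z z∈ , reg-z)
      where
      q≢t₁ : q ≢ t₁
      q≢t₁ refl = <-asym (proj₂ qw-m) (proj₂ wt₁)
    ...     | no t₁≢t₂ = w , t₁ , regular-w , wt₁ ,
                size-< Ru (proj₁ wt₁) (branch-nested w∈ (proj₁ wt₁) R∉t₁) w w∈ (root∉branch (proj₁ wt₁))
      where
      q≢t₁ : q ≢ t₁
      q≢t₁ refl = <-asym (proj₂ qw-m) (proj₂ wt₁)
      q≢t₂ : q ≢ t₂
      q≢t₂ refl = <-asym (proj₂ qw-R) (proj₂ wt₂)
      R∉t₁ : ¬ Br w t₁ R
      R∉t₁ R∈ = t₁≢t₂ (branch⇒toward-unique (proj₁ wt₁) R∈ wt₂)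
      regular-w : RegularCore G w
      regular-w = cored-on-three-sides⇒regular (edge-sym (proj₁ qw-m)) (proj₁ wt₁) (proj₁ wt₂) q≢t₁ q≢t₂ t₁≢t₂
        (z , z∈ , proj₁ reg-z) (m , toward⇒branch wt₁ , core-m) (R , toward⇒branch wt₂ , core-R)

    reach : ∀ (k : ℕ) {R u} → size R u < k → RegularCore G R → Toward R u m → OnModifiedLeg
    reach (suc k) {R} {u} size<k reg-R Ru-m with has-regular? (proj₁ Ru-m)
    ... | no ¬reg = from-gleg (branch-gleg (proj₁ Ru-m) ¬reg (proj₁ reg-R))
      where
      from-gleg : GLeg G R u → OnModifiedLeg
      from-gleg (inj₁ leg) = ⊥-elim (proj₂ leg m (toward⇒branch Ru-m) core-m)
      from-gleg (inj₂ (w , ml)) with proj₂ (proj₂ (proj₂ ml)) m (toward⇒branch Ru-m) core-m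
      ... | refl = R , u , reg-R , ml
    ... | yes (z , z∈ , reg-z) with toward {z} {m} z≢m | toward {z} {R} z≢R
      where
      z≢m : z ≢ m
      z≢m refl = ¬reg-m reg-z
      z≢R : z ≢ R
      z≢R refl = root∉branch (proj₁ Ru-m) z∈
    ...   | t₁ , zt₁ | t₂ , zt₂ with t₁ ≟ᶠ t₂
    ...     | no t₁≢t₂ = reach k (≤-trans (size-< (proj₁ Ru-m) (proj₁ zt₁) (branch-nested z∈ (proj₁ zt₁) R∉t₁)
                                                   z z∈ (root∉branch (proj₁ zt₁))) (≤-pred size<k)) reg-z zt₁
      where
      R∉t₁ : ¬ Br z t₁ R
      R∉t₁ R∈ = t₁≢t₂ (branch⇒toward-unique (proj₁ zt₁) R∈ zt₂)
    ...     | yes refl with split-point (suc (d z m)) ≤-refl (proj₁ reg-R) (proj₁ Ru-m) (toward⇒branch Ru-m)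
                                        z∈ zt₁ zt₂ (z , neighbour∈branch (edge-sym (proj₁ zt₁)) , reg-z)
    ...       | R' , u' , reg' , R'u'-m , size< = reach k (≤-trans size< (≤-pred size<k)) reg' R'u'-m

    on-modified-leg : ∀ {R} → RegularCore G R → OnModifiedLeg
    on-modified-leg {R} reg-R = reach (suc (size R _)) ≤-refl reg-R (proj₂ (toward {R} {m} R≢m))
      where
      R≢m : R ≢ m
      R≢m refl = ¬reg-m reg-R

module Landmarks (G : Tree) (L : Subset (Tree.n G))
  (local : ∀ v → RegularCore G v → LocalSet G v (λ x → x ∈ L × OnGLeg G v x)) where
  open Tree G using (n)
  open TreeFacts G
  open LocalSet

  S : Fin n → Fin n → Set
  S v x = x ∈ L × OnGLeg G v x

  record TwoLandmarks (P : Fin n → Set) : Set where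
    constructor two
    field
      t₁ t₂ : Fin n
      t₁≢t₂ : t₁ ≢ t₂
      t₁∈L  : t₁ ∈ L
      t₂∈L  : t₂ ∈ L
      P-t₁  : P t₁
      P-t₂  : P t₂

  map-two : ∀ {P Q : Fin n → Set} → (∀ x → P x → Q x) → TwoLandmarks P → TwoLandmarks Q
  map-two f (two t₁ t₂ ne l₁ l₂ p₁ p₂) = two t₁ t₂ ne l₁ l₂ (f t₁ p₁) (f t₂ p₂)

  OneLandmark : Fin n → Fin n → Set
  OneLandmark r u = Σ (Fin n) λ t → t ∈ L × Br r u t

  Branches₂ : Fin n → Fin n → Fin n → Fin n → Set
  Branches₂ m a b t = Br m a t ⊎ Br m b t

  combine : ∀ {r u₁ u₂} → E r u₁ → E r u₂ → u₁ ≢ u₂ → OneLandmark r u₁ → OneLandmark r u₂ →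
            TwoLandmarks (Branches₂ r u₁ u₂)
  combine e₁ e₂ u₁≢u₂ (t₁ , l₁ , t₁∈) (t₂ , l₂ , t₂∈) =
    two t₁ t₂ (λ { refl → u₁≢u₂ (branch⇒toward-unique e₁ t₁∈ (e₂ , branch⇒closer e₂ t₂∈)) }) l₁ l₂ (inj₁ t₁∈) (inj₂ t₂∈)

  two-in-branch : ∀ {r u} → (∃[ x ] ∃[ y ] (x ≢ y × Br r u x × S r x × Br r u y × S r y)) → TwoLandmarks (Br r u)
  two-in-branch (x , y , x≢y , x∈ , Sx , y∈ , Sy) = two x y x≢y (proj₁ Sx) (proj₁ Sy) x∈ y∈

  -- What the local set at a regular core r says about one g-leg of r:
  -- it carries two landmarks, it is an empty standard leg, or it carries one.
  data LegClass (r u : Fin n) : Set where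
    has-two  : TwoLandmarks (Br r u) → LegClass r u
    empty    : IsLeg G r u → TypeS0 G (S r) r u → LegClass r u
    has-one  : OneLandmark r u → LegClass r u

  classify : ∀ {r u} → RegularCore G r → GLeg G r u → LegClass r u
  classify {r} {u} reg (inj₁ leg) with c1-types (local r reg) u leg
  ... | inj₁ s0 = empty leg s0
  ... | inj₂ (inj₁ (y , y∈ , Sy , _)) = has-one (y , proj₁ Sy , y∈)
  ... | inj₂ (inj₂ (inj₁ s2)) = has-two (two-in-branch s2)
  ... | inj₂ (inj₂ (inj₂ (Su , _))) = has-one (u , proj₁ Su , neighbour∈branch (proj₁ leg))
  classify {r} {u} reg (inj₂ (w , ml)) with c2 (local r reg) u w ml
  ... | inj₁ (y , (y∈ , _) , Sy , _) = has-one (y , proj₁ Sy , y∈)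
  ... | inj₂ (inj₁ (_ , x , y , x≢y , x∈ , Sx , _ , y∈ , Sy , _)) = has-two (two x y x≢y (proj₁ Sx) (proj₁ Sy) x∈ y∈)
  ... | inj₂ (inj₂ (s3 , _)) = has-two (two-in-branch s3)

  modified-beside-empty : ∀ {r u u' w} → RegularCore G r → IsLeg G r u' → TypeS0 G (S r) r u' →
                          ModLeg G r u w → TwoLandmarks (Br r u)
  modified-beside-empty {r} {u} {u'} {w} reg leg' s0 ml with c2 (local r reg) u w ml
  ... | inj₁ m1 = ⊥-elim (c3 (local r reg) (u' , leg' , s0) u w ml m1)
  ... | inj₂ (inj₁ (_ , x , y , x≢y , x∈ , Sx , _ , y∈ , Sy , _)) = two x y x≢y (proj₁ Sx) (proj₁ Sy) x∈ y∈
  ... | inj₂ (inj₂ (s3 , _)) = two-in-branch s3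

  -- Two legs of a regular core of degree 3 are both long, since a degree-3
  -- core with a leg and a short leg is small.
  long-legs : ∀ {r a b} → RegularCore G r → ¬ (4 ≤ deg G r) → a ≢ b → IsLeg G r a → IsLeg G r b →
              LongLeg G r a × LongLeg G r b
  long-legs {r} {a} {b} reg deg<4 a≢b leg-a leg-b =
    (leg-a , λ short → proj₂ reg (deg≡3 , b , a , ≢-sym a≢b , leg-b , leg-a , short)) ,
    (leg-b , λ short → proj₂ reg (deg≡3 , a , b , a≢b , leg-a , leg-b , short))
    where
    deg≡3 : deg G r ≡ 3
    deg≡3 = ≤-antisym (≤-pred (≰⇒> deg<4)) (proj₁ reg)

  Away : Fin n → Fin n → Fin n → Set
  Away r t x = Σ (Fin n) λ u → E r u × u ≢ t × Br r u x

  module AtRegular {r t : Fin n} (reg : RegularCore G r)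
    (each : ∀ {u} → E r u → u ≢ t → TwoLandmarks (Br r u) ⊎ GLeg G r u) where

    into : ∀ {u} → E r u → u ≢ t → ∀ x → Br r u x → Away r t x
    into e u≢t x x∈ = _ , e , u≢t , x∈

    into₂ : ∀ {u₁ u₂} → E r u₁ → E r u₂ → u₁ ≢ t → u₂ ≢ t → ∀ x → Branches₂ r u₁ u₂ x → Away r t x
    into₂ e₁ e₂ u₁≢t u₂≢t x = Sum.[ into e₁ u₁≢t x , into e₂ u₂≢t x ]

    data View (u : Fin n) : Set where
      found        : TwoLandmarks (Away r t) → View u
      empty-leg    : IsLeg G r u → TypeS0 G (S r) r u → View u
      one-landmark : GLeg G r u → OneLandmark r u → View u

    view : ∀ {u} → E r u → u ≢ t → View u
    view e u≢t with each e u≢t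
    ... | inj₁ T = found (map-two (into e u≢t) T)
    ... | inj₂ g with classify reg g
    ...   | has-two T = found (map-two (into e u≢t) T)
    ...   | empty leg s0 = empty-leg leg s0
    ...   | has-one o = one-landmark g o

    -- An empty standard leg at ua and one landmark at ub: the second
    -- landmark comes from a third branch if deg r ≥ 4, from condition (3)
    -- if ub is modified, and from condition (4) otherwise.
    empty-and-one : ∀ {ua ub} → E r ua → E r ub → ua ≢ t → ub ≢ t → ua ≢ ub →
                    IsLeg G r ua → TypeS0 G (S r) r ua → GLeg G r ub → OneLandmark r ub → TwoLandmarks (Away r t)
    empty-and-one ea eb ua≢t ub≢t ua≢ub leg-a s0 (inj₂ (w , ml)) _ =
      map-two (into eb ub≢t) (modified-beside-empty reg leg-a s0 ml)
    empty-and-one {ua} {ub} ea eb ua≢t ub≢t ua≢ub leg-a s0 (inj₁ leg-b) ob with 4 ≤? deg G r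
    ... | yes deg≥4 = third (fresh-neighbour (t ∷ ua ∷ ub ∷ []) deg≥4)
      where
      third : (Σ (Fin n) λ u₃ → E r u₃ × u₃ ∉ᴸ (t ∷ ua ∷ ub ∷ [])) → TwoLandmarks (Away r t)
      third (u₃ , e₃ , u₃∉) with view e₃ (λ eq → u₃∉ (hd eq))
      ... | found T = T
      ... | one-landmark _ o₃ = map-two (into₂ eb e₃ ub≢t (λ eq → u₃∉ (hd eq)))
                                  (combine eb e₃ (λ eq → u₃∉ (tl (tl (hd (sym eq))))) ob o₃)
      ... | empty-leg leg₃ s0₃ = ⊥-elim (u₃∉ (tl (hd (sym (c1-unique (local r reg) ua u₃ leg-a leg₃ s0 s0₃)))))
    ... | no deg<4 with long-legs reg deg<4 ua≢ub leg-a leg-b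
    ...   | long-a , long-b = map-two (into eb ub≢t) (two-in-branch (c4 (local r reg) ua long-a s0 ub long-b (≢-sym ua≢ub)))

    pair : ∀ {u₁ u₂} → E r u₁ → E r u₂ → u₁ ≢ t → u₂ ≢ t → u₁ ≢ u₂ → TwoLandmarks (Away r t)
    pair e₁ e₂ u₁≢t u₂≢t u₁≢u₂ with view e₁ u₁≢t | view e₂ u₂≢t
    ... | found T | _ = T
    ... | _ | found T = T
    ... | one-landmark _ o₁ | one-landmark _ o₂ = map-two (into₂ e₁ e₂ u₁≢t u₂≢t) (combine e₁ e₂ u₁≢u₂ o₁ o₂)
    ... | empty-leg l₁ s₁ | empty-leg l₂ s₂ = ⊥-elim (u₁≢u₂ (c1-unique (local r reg) _ _ l₁ l₂ s₁ s₂))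
    ... | empty-leg l₁ s₁ | one-landmark g₂ o₂ = empty-and-one e₁ e₂ u₁≢t u₂≢t u₁≢u₂ l₁ s₁ g₂ o₂
    ... | one-landmark g₁ o₁ | empty-leg l₂ s₂ = empty-and-one e₂ e₁ u₂≢t u₁≢t (≢-sym u₁≢u₂) l₂ s₂ g₁ o₁

    -- a core has two neighbours other than t
    result : TwoLandmarks (Away r t)
    result with fresh-neighbour (t ∷ []) (≤-trans (s≤s (s≤s z≤n)) (proj₁ reg))
    ... | u₁ , e₁ , u₁∉ with fresh-neighbour (t ∷ u₁ ∷ []) (proj₁ reg)
    ...   | u₂ , e₂ , u₂∉ = pair e₁ e₂ (λ eq → u₁∉ (hd eq)) (λ eq → u₂∉ (hd eq)) (λ eq → u₂∉ (tl (hd (sym eq))))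

  -- Let t be the neighbour of r toward m.  The other branches of r lie
  -- inside (m, a) and are g-legs of r unless they contain a regular core,
  -- in which case they are smaller branches and the claim recurses.
  regular-branch : ∀ (k : ℕ) {m a} → size m a < k → E m a → HasRegular m a → TwoLandmarks (Br m a)
  regular-branch (suc k) {m} {a} size<k ma (r , r∈ , reg) with toward {r} {m} (λ { refl → root∉branch ma r∈ })
  ... | t , rt = map-two (λ x → λ { (u , e , u≢t , x∈) → inside e u≢t x x∈ }) (AtRegular.result reg each)
    where
    inside : ∀ {u} → E r u → u ≢ t → ∀ x → Br r u x → Br m a x
    inside e u≢t = branch-nested r∈ e (λ m∈ → u≢t (branch⇒toward-unique e m∈ rt))

    each : ∀ {u} → E r u → u ≢ t → TwoLandmarks (Br r u) ⊎ GLeg G r u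
    each e u≢t with has-regular? e
    ... | yes hr = inj₁ (regular-branch k (≤-trans (size-< ma e (inside e u≢t) r r∈ (root∉branch e)) (≤-pred size<k)) e hr)
    ... | no ¬hr = inj₂ (branch-gleg e ¬hr (proj₁ reg))

  beside-empty : ∀ {m a b x y} → RegularCore G m → E m a → E m b → a ≢ b → IsLeg G m a → TypeS0 G (S m) m a →
                 GLeg G m b → Br m a x → Br m b y → y ∉ L → d m x ≡ d m y → TwoLandmarks (Br m b)
  beside-empty reg ma mb a≢b leg-a s0 (inj₂ (w , ml)) x∈ y∈ y∉L mx≡my = modified-beside-empty reg leg-a s0 ml
  beside-empty {m} {a} {b} {x} {y} reg ma mb a≢b leg-a s0 (inj₁ leg-b) x∈ y∈ y∉L mx≡my with short-leg? m b
  ... | yes short-b = ⊥-elim (short-type (c1-types (local m reg) b leg-b))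
    where
    -- a short leg at b containing y ∉ L can have no type at all
    short-type : TypeS0 G (S m) m b ⊎ TypeS1 G (S m) m b ⊎ TypeS2 G (S m) m b ⊎ TypeS3 G (S m) m b → ⊥
    short-type (inj₁ s0-b) = a≢b (c1-unique (local m reg) a b leg-a leg-b s0 s0-b)
    short-type (inj₂ (inj₁ (z , z∈ , _ , 2≤mz , _))) with proj₂ short-b z z∈
    ... | refl = <-irrefl refl (≤-trans 2≤mz (≤-reflexive (dist-edge mb)))
    short-type (inj₂ (inj₂ (inj₁ (z , z' , z≢z' , z∈ , _ , z'∈ , _)))) =
      z≢z' (trans (proj₂ short-b z z∈) (sym (proj₂ short-b z' z'∈)))
    short-type (inj₂ (inj₂ (inj₂ (Sb , _)))) = y∉L (subst (_∈ L) (sym (proj₂ short-b y y∈)) (proj₁ Sb))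
  ... | no ¬short-b with short-leg? m a
  ...   | no ¬short-a = two-in-branch (c4 (local m reg) a (leg-a , λ s → ¬short-a (leg-a , s)) s0 b
                                             (leg-b , λ s → ¬short-b (leg-b , s)) (≢-sym a≢b))
  ...   | yes short-a with c5 (local m reg) a short-a s0 b (leg-b , λ s → ¬short-b (leg-b , s))
  ...     | inj₁ s2 = two-in-branch s2
  ...     | inj₂ (Sb , _) = ⊥-elim (y∉L (subst (_∈ L) (sym y≡b) (proj₁ Sb)))
    where
    -- x lies in the short leg, so d m y = d m x = 1
    y≡b : y ≡ b
    y≡b = branch-adjacent mb y∈ (trans (sym mx≡my) (trans (cong (d m) (proj₂ short-a x x∈)) (dist-edge ma)))

  -- Case: m is a regular core.  Both branches are g-legs of m.
  regular-midpoint : ∀ {m a b x y} → RegularCore G m → E m a → E m b → a ≢ b →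
                     ¬ HasRegular m a → ¬ HasRegular m b → Br m a x → Br m b y → x ∉ L → y ∉ L →
                     d m x ≡ d m y → TwoLandmarks (Branches₂ m a b)
  regular-midpoint {m} {a} {b} reg ma mb a≢b ¬reg-a ¬reg-b x∈ y∈ x∉L y∉L mx≡my
    with classify reg (branch-gleg ma ¬reg-a (proj₁ reg)) | classify reg (branch-gleg mb ¬reg-b (proj₁ reg))
  ... | has-two T | _ = map-two (λ _ → inj₁) T
  ... | _ | has-two T = map-two (λ _ → inj₂) T
  ... | has-one o₁ | has-one o₂ = combine ma mb a≢b o₁ o₂
  ... | empty l₁ s₁ | empty l₂ s₂ = ⊥-elim (a≢b (c1-unique (local m reg) a b l₁ l₂ s₁ s₂))
  ... | empty l₁ s₁ | has-one _ =
    map-two (λ _ → inj₂) (beside-empty reg ma mb a≢b l₁ s₁ (branch-gleg mb ¬reg-b (proj₁ reg)) x∈ y∈ y∉L mx≡my)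
  ... | has-one _ | empty l₂ s₂ =
    map-two (λ _ → inj₁) (beside-empty reg mb ma (≢-sym a≢b) l₂ s₂ (branch-gleg ma ¬reg-a (proj₁ reg)) y∈ x∈ x∉L (sym mx≡my))

  leg-unless-c : ∀ {m u₁ u₂ c a} → deg G m ≡ 3 → IsLeg G m u₁ → IsLeg G m u₂ → u₁ ≢ u₂ → u₁ ≢ c → u₂ ≢ c →
                 E m c → E m a → a ≢ c → IsLeg G m a
  leg-unless-c m-deg3 leg₁ leg₂ u₁≢u₂ u₁≢c u₂≢c mc ma a≢c
    with degree-3-neighbours m-deg3 (proj₁ leg₁) (proj₁ leg₂) mc u₁≢u₂ u₁≢c u₂≢c ma
  ... | inj₁ refl = leg₁
  ... | inj₂ (inj₁ refl) = leg₂
  ... | inj₂ (inj₂ refl) = ⊥-elim (a≢c refl)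

  equidistant-in-legs : ∀ {m a b c x y u} → deg G m ≡ 3 → E m a → E m b → E m c → a ≢ b → a ≢ c → b ≢ c →
                        ShortLeg G m u → u ≢ c → Br m a x → Br m b y → d m x ≡ d m y → (x ≡ a) × (y ≡ b)
  equidistant-in-legs m-deg3 ma mb mc a≢b a≢c b≢c short u≢c x∈ y∈ mx≡my
    with degree-3-neighbours m-deg3 ma mb mc a≢b a≢c b≢c (proj₁ (proj₁ short))
  ... | inj₁ refl = x≡a , branch-adjacent mb y∈ (trans (sym mx≡my) (trans (cong (d _) x≡a) (dist-edge ma)))
    where x≡a = proj₂ short _ x∈
  ... | inj₂ (inj₁ refl) = branch-adjacent ma x∈ (trans mx≡my (trans (cong (d _) y≡b) (dist-edge mb))) , y≡b
    where y≡b = proj₂ short _ y∈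
  ... | inj₂ (inj₂ refl) = ⊥-elim (u≢c refl)

  -- A small core m of degree 3 with legs at a, b ∉ L lying on a modified
  -- leg of a regular core R: by condition (2) at R, that leg carries two
  -- landmarks beyond m, since its two vertices right after m are a and b.
  beyond-small-core : ∀ {m a b c R u} → deg G m ≡ 3 → E m a → E m b → a ≢ b → IsLeg G m a → IsLeg G m b →
                      a ∉ L → b ∉ L → RegularCore G R → ModLeg G R u m → Toward m c R →
                      TwoLandmarks (Branches₂ m a b)
  beyond-small-core {m} {a} {b} {c} {R} {u} m-deg3 ma mb a≢b leg-a leg-b a∉L b∉L reg-R ml@(Ru , m∈ , _ , only-m) mc =
    by-type (c2 (local R reg-R) u m ml)
    where
    a≢c : a ≢ c
    a≢c refl = proj₂ leg-a R (toward⇒branch mc) (proj₁ reg-R)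
    b≢c : b ≢ c
    b≢c refl = proj₂ leg-b R (toward⇒branch mc) (proj₁ reg-R)

    open ModifiedLeg Ru m∈ only-m mc
    open DegreeThree m-deg3 ma mb a≢b a≢c b≢c leg-a leg-b (proj₁ reg-R)

    not-a-or-b : ∀ {z} → z ∈ L → z ≡ a ⊎ z ≡ b → ⊥
    not-a-or-b z∈L (inj₁ refl) = a∉L z∈L
    not-a-or-b z∈L (inj₂ refl) = b∉L z∈L

    by-type : TypeM1 G (S R) R u m ⊎ TypeM2 G (S R) R u m ⊎ TypeM3 G (S R) R u m → TwoLandmarks (Branches₂ m a b)
    by-type (inj₁ (z , (z∈ , Rz≡) , Sz , _)) = ⊥-elim (not-a-or-b (proj₁ Sz) (just-beyond-core z∈ Rz≡))
    by-type (inj₂ (inj₁ (_ , z , z' , z≢z' , z∈ , Sz , far , z'∈ , Sz' , far'))) =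
      two z z' z≢z' (proj₁ Sz) (proj₁ Sz') (far-beyond-core z∈ far) (far-beyond-core z'∈ far')
    by-type (inj₂ (inj₂ (_ , (z , (z∈ , Rz≡) , Sz)))) = ⊥-elim (not-a-or-b (proj₁ Sz) (just-beyond-core z∈ Rz≡))

  -- With c the neighbour of m toward a regular
  -- core v, m has three neighbours, so it is a small core; its legs are
  -- the branches at a and b (c leads to v), so x = a and y = b; and m
  -- lies on a modified leg of some regular core R.
  small-midpoint : ∀ {m a b x y v} → RegularCore G v → ¬ RegularCore G m → E m a → E m b → a ≢ b →
                   ¬ HasRegular m a → ¬ HasRegular m b → Br m a x → Br m b y → x ∉ L → y ∉ L →
                   d m x ≡ d m y → TwoLandmarks (Branches₂ m a b)
  small-midpoint {m} {a} {b} {x} {y} {v} reg-v ¬reg-m ma mb a≢b ¬reg-a ¬reg-b x∈ y∈ x∉L y∉L mx≡my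
    with toward {m} {v} (λ { refl → ¬reg-m reg-v })
  ... | c , mc with small-of (three-neighbours⇒core ma mb (proj₁ mc) a≢b a≢c b≢c) ¬reg-m
    where
    a≢c : a ≢ c
    a≢c refl = ¬reg-a (v , toward⇒branch mc , reg-v)
    b≢c : b ≢ c
    b≢c refl = ¬reg-b (v , toward⇒branch mc , reg-v)
  ...   | m-deg3 , u₁ , u₂ , u₁≢u₂ , leg₁ , short₂
    with SmallCoreOnModifiedLeg.on-modified-leg m-deg3 u₁≢u₂ leg₁ (proj₁ short₂) ¬reg-m reg-v
  ...     | R , u , reg-R , ml with toward {m} {R} (λ { refl → ¬reg-m reg-R })
  ...       | c' , mc' = beyond-small-core m-deg3 ma mb a≢b leg-a leg-b
                           (λ a∈L → x∉L (subst (_∈ L) (sym x≡a) a∈L)) (λ b∈L → y∉L (subst (_∈ L) (sym y≡b) b∈L))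
                           reg-R ml mc'
    where
    a≢c : a ≢ c
    a≢c refl = ¬reg-a (v , toward⇒branch mc , reg-v)
    b≢c : b ≢ c
    b≢c refl = ¬reg-b (v , toward⇒branch mc , reg-v)
    u₁≢c : u₁ ≢ c
    u₁≢c refl = proj₂ leg₁ v (toward⇒branch mc) (proj₁ reg-v)
    u₂≢c : u₂ ≢ c
    u₂≢c refl = proj₂ (proj₁ short₂) v (toward⇒branch mc) (proj₁ reg-v)
    leg-a : IsLeg G m a
    leg-a = leg-unless-c m-deg3 leg₁ (proj₁ short₂) u₁≢u₂ u₁≢c u₂≢c (proj₁ mc) ma a≢c
    leg-b : IsLeg G m b
    leg-b = leg-unless-c m-deg3 leg₁ (proj₁ short₂) u₁≢u₂ u₁≢c u₂≢c (proj₁ mc) mb b≢c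
    x≡a : x ≡ a
    x≡a = proj₁ (equidistant-in-legs m-deg3 ma mb (proj₁ mc) a≢b a≢c b≢c short₂ u₂≢c x∈ y∈ mx≡my)
    y≡b : y ≡ b
    y≡b = proj₂ (equidistant-in-legs m-deg3 ma mb (proj₁ mc) a≢b a≢c b≢c short₂ u₂≢c x∈ y∈ mx≡my)

  fork-landmarks : ∀ {x y v} → RegularCore G v → x ∉ L → y ∉ L → (F : Fork x y) →
                   TwoLandmarks (Branches₂ (Fork.m F) (Fork.a F) (Fork.b F))
  fork-landmarks reg-v x∉L y∉L (fork m a b ma mb a≢b x∈a y∈b equidistant)
    with has-regular? ma | has-regular? mb | regular-core? m
  ... | yes hr | _ | _ = map-two (λ _ → inj₁) (regular-branch (suc (size m a)) ≤-refl ma hr)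
  ... | no _ | yes hr | _ = map-two (λ _ → inj₂) (regular-branch (suc (size m b)) ≤-refl mb hr)
  ... | no ¬reg-a | no ¬reg-b | yes reg-m =
    regular-midpoint reg-m ma mb a≢b ¬reg-a ¬reg-b x∈a y∈b x∉L y∉L equidistant
  ... | no ¬reg-a | no ¬reg-b | no ¬reg-m =
    small-midpoint reg-v ¬reg-m ma mb a≢b ¬reg-a ¬reg-b x∈a y∈b x∉L y∉L equidistant

  fork-separates : ∀ {x y} (F : Fork x y) → ∀ τ → Branches₂ (Fork.m F) (Fork.a F) (Fork.b F) τ → Separates G τ x y
  fork-separates (fork m a b ma mb a≢b x∈a y∈b equidistant) τ (inj₁ τ∈) =
    <⇒≢ (separates-across ma mb a≢b x∈a y∈b equidistant τ∈)
  fork-separates (fork m a b ma mb a≢b x∈a y∈b equidistant) τ (inj₂ τ∈) =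
    ≢-sym (<⇒≢ (separates-across mb ma (≢-sym a≢b) y∈b x∈a (sym equidistant) τ∈))

  -- With two regular cores, the branch at one toward the other yields two landmarks.
  two-landmarks : ∀ {v₁ v₂} → v₁ ≢ v₂ → RegularCore G v₂ → TwoLandmarks (λ _ → ⊤)
  two-landmarks {v₁} {v₂} v₁≢v₂ reg₂ with toward {v₁} {v₂} v₁≢v₂
  ... | t , v₁t = map-two (λ _ _ → tt) (regular-branch (suc (size v₁ t)) ≤-refl (proj₁ v₁t) (v₂ , toward⇒branch v₁t , reg₂))

  Separated : Fin n → Fin n → Set
  Separated x y = ∃[ τ₁ ] ∃[ τ₂ ] (τ₁ ≢ τ₂ × τ₁ ∈ L × τ₂ ∈ L × Separates G τ₁ x y × Separates G τ₂ x y)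

  separated-by : ∀ {P : Fin n → Set} {x y} → TwoLandmarks P → (∀ τ → P τ → Separates G τ x y) → Separated x y
  separated-by (two t₁ t₂ t₁≢t₂ t₁∈L t₂∈L p₁ p₂) sep = t₁ , t₂ , t₁≢t₂ , t₁∈L , t₂∈L , sep t₁ p₁ , sep t₂ p₂

lemma6 : (G : Tree) (L : Subset (Tree.n G)) →
    (∃[ v₁ ] ∃[ v₂ ] (v₁ ≢ v₂ × RegularCore G v₁ × RegularCore G v₂)) →
    (∀ v → RegularCore G v → LocalSet G v (λ x → x ∈ L × OnGLeg G v x)) →
    IsLandmark G L
lemma6 G L (v₁ , v₂ , v₁≢v₂ , reg₁ , reg₂) local x y x≢y x∉L y∉L = by-parity (even? (dist G x y))
  where
  open TreeFacts G
  open Landmarks G L local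

  by-parity : Dec (Even (dist G x y)) → Separated x y
  by-parity (no odd) = separated-by (two-landmarks v₁≢v₂ reg₂) (λ τ _ → odd-distance-separates odd τ)
  by-parity (yes even) = separated-by (fork-landmarks reg₁ x∉L y∉L F) (fork-separates F)
    where F = even-distance-fork x≢y even
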